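{- Let $q\ge2$, $n\ge1$, and let $\mathbf f\in A_q^+$ be a word whose last symbol is neither $0$ nor $q-1$. Then $A_q^n(\mathbf f)$ listed in $\prec$ order if $q$ is even (resp. in $\triangleleft$ order if $q$ is odd) is a $2$-adjacent Gray code: any two consecutive words in the list differ in at most two positions, and if they differ in two positions these positions are adjacent.
   Context: $A_q=\{0,1,\dots,q-1\}$; $A_q^n$ is the set of length-$n$ words over $A_q$, $A_q^+$ the nonempty finite words. $A_q^n(\mathbf f)$ is the set of words of $A_q^n$ not containing $\mathbf f$ as a factor (contiguous subword). For distinct words $\mathbf s,\mathbf t$ of equal length, with $k$ the leftmost differing position, $u=\sum_{i<k}s_i$, $v$ the number of nonzero symbols among $s_1,\dots,s_{k-1}$: $\mathbf s\prec\mathbf t$ iff ($u$ even and $s_k<t_k$) or ($u$ odd and $s_k>t_k$); $\mathbf s\triangleleft\mathbf t$ iff ($u+v$ even and $s_k<t_k$) or ($u+v$ odd and $s_k>t_k$). -}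

module Defs where

open import Data.Nat using (ℕ; zero; suc; _+_; _∸_; _%_; _≤_)
open import Data.Fin using (Fin; toℕ)
open import Data.Vec using (Vec; []; _∷_; toList)
open import Data.List using (List; _++_)
open import Data.Product using (_×_; ∃; ∃-syntax; Σ)
open import Data.Sum using (_⊎_)
open import Data.Empty using (⊥)
open import Relation.Nullary using (¬_)
open import Relation.Binary.PropositionalEquality using (_≡_; _≢_)

Word : ℕ → ℕ → Set
Word q n = Vec (Fin q) n

IsFactor : ∀ {q m n} → Vec (Fin q) m → Word q n → Set
IsFactor {q} f w = ∃[ u ] ∃[ v ] (toList w ≡ u ++ toList f ++ v)

Avoids : ∀ {q m n} → Vec (Fin q) m → Word q n → Set
Avoids f w = ¬ IsFactor f w

Even : ℕ → Set
Even a = a % 2 ≡ 0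

-- Generic reflected order: acc is the accumulated weight of the common prefix;
-- at the leftmost differing position k, s ≺ t iff (acc even and s_k < t_k)
-- or (acc odd and s_k > t_k).
data GLess {q : ℕ} (wt : Fin q → ℕ) : ℕ → ∀ {n} → Word q n → Word q n → Set where
  here-even : ∀ {acc n x y} {xs ys : Word q n} → Even acc → toℕ x Data.Nat.< toℕ y →
              GLess wt acc (x ∷ xs) (y ∷ ys)
  here-odd  : ∀ {acc n x y} {xs ys : Word q n} → ¬ Even acc → toℕ y Data.Nat.< toℕ x →
              GLess wt acc (x ∷ xs) (y ∷ ys)
  there     : ∀ {acc n x} {xs ys : Word q n} → GLess wt (acc + wt x) xs ys →
              GLess wt acc (x ∷ xs) (x ∷ ys)

-- u = sum of s_1..s_{k-1}
wt≺ : ∀ {q} → Fin q → ℕ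
wt≺ x = toℕ x

-- u + v where v counts nonzero symbols among s_1..s_{k-1}
nz : ℕ → ℕ
nz zero = 0
nz (suc _) = 1

wt◁ : ∀ {q} → Fin q → ℕ
wt◁ x = toℕ x + nz (toℕ x)

_≺_ : ∀ {q n} → Word q n → Word q n → Set
s ≺ t = GLess wt≺ 0 s t

_◁_ : ∀ {q n} → Word q n → Word q n → Set
s ◁ t = GLess wt◁ 0 s t

GrayOrder : ∀ q {n} → Word q n → Word q n → Set
GrayOrder q s t = (Even q × (s ≺ t)) ⊎ (¬ Even q × (s ◁ t))

-- s and t differ in at most two positions, and if two, they are adjacent:
-- any two differing positions are at distance at most 1.
TwoAdjacent : ∀ {q n} → Word q n → Word q n → Set
TwoAdjacent {n = n} s t = ∀ (j k : Fin n) →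
  Data.Vec.lookup s j ≢ Data.Vec.lookup t j →
  Data.Vec.lookup s k ≢ Data.Vec.lookup t k →
  toℕ j ≤ suc (toℕ k)

Consecutive : ∀ {q m n} → (Word q n → Word q n → Set) → Vec (Fin q) m →
              Word q n → Word q n → Set
Consecutive {q} {n = n} R f s t =
  Avoids f s × Avoids f t × R s t ×
  ¬ (Σ (Word q n) λ w → Avoids f w × R s w × R w t)

module Submission where

-- Let s ≺ t be consecutive f-avoiding words and let k be the
-- first position where they differ, so s = p a x and t = p b y.  Among all
-- words with prefix p a, the reflected order has a greatest element
-- p a (largest) 0…0, and among those with prefix p b a least element
-- p b (smallest) 0…0, where the only letters used are the extreme letters
-- 0 and q-1.  Because the last letter of f is not extreme, writing extreme
-- letters after position k cannot create an occurrence of f; so these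
-- extremal words still avoid f, and since no f-avoiding word lies strictly
-- between s and t we get x = maximum and y = minimum.  Hence s and t agree
-- everywhere except possibly at positions k and k+1.

open import Defs
open import Data.Nat using (ℕ; zero; suc; _+_; _∸_; _%_; _≤_; z≤n; s≤s)
open import Data.Nat.Properties using (+-identityʳ; +-comm; ≤∧≢⇒<)
import Data.Nat as ℕ
open import Data.Fin using (Fin; toℕ; fromℕ) renaming (zero to fz; suc to fs)
open import Data.Fin.Properties using (toℕ-injective; toℕ-fromℕ; ≤fromℕ; _≟_)
open import Data.Vec using (Vec; []; _∷_; toList; replicate; last; init; initLast)
open import Data.Vec.Properties using (toList-∷ʳ)
open import Data.List using (List; _++_; [_])
import Data.List as List
open import Data.List.Properties using (++-assoc; ∷-injectiveˡ; ∷-injectiveʳ)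
open import Data.List.Relation.Unary.All using (All; []; _∷_; head)
open import Data.List.Relation.Unary.All.Properties using (++⁻ʳ)
open import Data.Product using (Σ; ∃-syntax; _,_; _×_; proj₂)
open import Data.Sum using (_⊎_; inj₁; inj₂; map; map₂; [_,_]′)
open import Data.Empty using (⊥-elim)
open import Relation.Nullary using (¬_; Dec; yes; no)
open import Relation.Binary.PropositionalEquality
  using (_≡_; _≢_; refl; sym; trans; cong; cong₂; subst; module ≡-Reasoning)

even-suc : ∀ a → Even (suc a) → ¬ Even a
even-suc zero ()
even-suc (suc zero) _ ()
even-suc (suc (suc a)) e = even-suc a e

odd-suc : ∀ a → ¬ Even (suc a) → Even a
odd-suc zero _ = refl
odd-suc (suc zero) o = ⊥-elim (o refl)
odd-suc (suc (suc a)) o = odd-suc a o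

even+odd : ∀ a b → Even a → ¬ Even b → ¬ Even (a + b)
even+odd zero b _ o = o
even+odd (suc zero) b () o
even+odd (suc (suc a)) b e o = even+odd a b e o

even? : (a : ℕ) → Dec (Even a)
even? a = a % 2 ℕ.≟ 0

-- Occurrences of a factor F in a list L, and the lists free of F.
-- `IsFactor f w` is `Occurs (toList f) (toList w)` and `Avoids f w` is
-- `FreeOf f (toList w)`, both by definition.

Occurs : ∀ {A : Set} → List A → List A → Set
Occurs F L = ∃[ u ] ∃[ v ] (L ≡ u ++ F ++ v)

FreeOf : ∀ {A : Set} {m} → Vec A m → List A → Set
FreeOf f L = ¬ Occurs (toList f) L

SuffixStable : ∀ {A : Set} → (A → Set) → (List A → Set) → Set
SuffixStable P Av = ∀ L X {E} → All P E → Av (L ++ X) → Av (L ++ E)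

occurs-++ʳ : ∀ {A : Set} {F L : List A} X → Occurs F L → Occurs F (L ++ X)
occurs-++ʳ {F = F} {L} X (u , v , eq) = u , v ++ X , (begin
  L ++ X               ≡⟨ cong (_++ X) eq ⟩
  (u ++ F ++ v) ++ X   ≡⟨ ++-assoc u (F ++ v) X ⟩
  u ++ (F ++ v) ++ X   ≡⟨ cong (u ++_) (++-assoc F v X) ⟩
  u ++ F ++ v ++ X     ∎)
  where open ≡-Reasoning

module _ {A : Set} (P : A → Set) {l : A} (¬Pl : ¬ P l) where

  split-before : ∀ L {E} H v → All P E → L ++ E ≡ H ++ l List.∷ v →
                 ∃[ v′ ] (L ≡ H ++ l List.∷ v′)
  split-before List.[] H v PE eq = ⊥-elim (¬Pl (head (++⁻ʳ H (subst (All P) eq PE))))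
  split-before (c List.∷ L) List.[] v PE eq = L , cong (List._∷ L) (∷-injectiveˡ eq)
  split-before (c List.∷ L) (h List.∷ H) v PE eq
    with split-before L H v PE (∷-injectiveʳ eq)
  ... | v′ , eq′ = v′ , cong₂ List._∷_ (∷-injectiveˡ eq) eq′

  regroup-last : ∀ u G w → u ++ (G ++ [ l ]) ++ w ≡ (u ++ G) ++ l List.∷ w
  regroup-last u G w =
    trans (cong (u ++_) (++-assoc G [ l ] w)) (sym (++-assoc u G (l List.∷ w)))

  occurs-within : ∀ {G} L {E} → All P E → Occurs (G ++ [ l ]) (L ++ E) →
                  Occurs (G ++ [ l ]) L
  occurs-within {G} L PE (u , v , eq)
    with split-before L (u ++ G) v PE (trans eq (regroup-last u G v))
  ... | v′ , eq′ = u , v′ , trans eq′ (sym (regroup-last u G v′))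

-- The words avoiding f are P-suffix-stable when the last letter of f fails P:
-- an occurrence of f after the rewriting already lies in the untouched prefix.
avoidance-stable : ∀ {A : Set} (P : A → Set) {m} (f : Vec A (suc m)) →
                   ¬ P (last f) → SuffixStable P (FreeOf f)
avoidance-stable P f ¬P-last L X PE free occ =
  free (occurs-++ʳ X (subst (λ F → Occurs F L) (sym split-last)
         (occurs-within P ¬P-last L PE (subst (λ F → Occurs F (L ++ _)) split-last occ))))
  where
  split-last : toList f ≡ toList (init f) ++ [ last f ]
  split-last = trans (cong toList (proj₂ (proj₂ (initLast f)))) (toList-∷ʳ (last f) (init f))

Extreme : ∀ {q} → Fin q → Set
Extreme {q} x = toℕ x ≡ 0 ⊎ toℕ x ≡ q ∸ 1

twoAdjacent-front : ∀ {q m} (a b h h′ : Fin q) (z : Word q m) →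
                    TwoAdjacent (a ∷ h ∷ z) (b ∷ h′ ∷ z)
twoAdjacent-front a b h h′ z fz k _ _ = z≤n
twoAdjacent-front a b h h′ z (fs fz) k _ _ = s≤s z≤n
twoAdjacent-front a b h h′ z (fs (fs i)) k ne _ = ⊥-elim (ne refl)

twoAdjacent-∷ : ∀ {q n} (c : Fin q) {s t : Word q n} →
                TwoAdjacent s t → TwoAdjacent (c ∷ s) (c ∷ t)
twoAdjacent-∷ c adj fz k ne _ = ⊥-elim (ne refl)
twoAdjacent-∷ c adj (fs j) fz _ ne = ⊥-elim (ne refl)
twoAdjacent-∷ c adj (fs j) (fs k) nj nk = s≤s (adj j k nj nk)

-- Raising the accumulated weight by one flips its parity and therefore
-- reverses the reflected order.
reverse-order : ∀ {q} {wt : Fin q → ℕ} {acc n} {s t : Word q n} →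
                GLess wt (suc acc) s t → GLess wt acc t s
reverse-order {acc = acc} (here-even e lt) = here-odd (even-suc acc e) lt
reverse-order {acc = acc} (here-odd o lt) = here-even (odd-suc acc o) lt
reverse-order (there lt) = there (reverse-order lt)

-- A reflected order over the alphabet {0,…,r+1} in which the letter 0 has
-- weight 0 and the top letter r+1 has odd weight.  Both ≺ (q even) and
-- ◁ (q odd) are instances.
module ReflectedOrder (r : ℕ) (wt : Fin (suc (suc r)) → ℕ)
  (wt-zero : wt fz ≡ 0) (wt-top-odd : ¬ Even (wt (fromℕ (suc r)))) where

  Q : ℕ
  Q = suc (suc r)

  W : ℕ → Set
  W = Word Q

  top : Fin Q
  top = fromℕ (suc r)

  zeros : ∀ k → W k
  zeros k = replicate k fz

  zeros-greatest : ∀ acc → ¬ Even acc → ∀ {k} (w : W k) →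
                   w ≡ zeros k ⊎ GLess wt acc w (zeros k)
  zeros-greatest acc o [] = inj₁ refl
  zeros-greatest acc o (fz ∷ xs) =
    map (cong (fz ∷_)) there (zeros-greatest (acc + wt fz) still-odd xs)
    where
    still-odd : ¬ Even (acc + wt fz)
    still-odd = subst (λ a → ¬ Even a) (sym (trans (cong (acc +_) wt-zero) (+-identityʳ acc))) o
  zeros-greatest acc o (fs x ∷ xs) = inj₂ (here-odd o (s≤s z≤n))

  largest : ℕ → Fin Q
  largest acc with even? acc
  ... | yes _ = top
  ... | no _ = fz

  maxW : ℕ → ∀ k → W k
  maxW acc zero = []
  maxW acc (suc k) = largest acc ∷ zeros k

  maxW-greatest : ∀ acc {k} (w : W k) → w ≡ maxW acc k ⊎ GLess wt acc w (maxW acc k)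
  maxW-greatest acc [] = inj₁ refl
  maxW-greatest acc (x ∷ xs) with even? acc
  ... | no o = zeros-greatest acc o (x ∷ xs)
  ... | yes e with x ≟ top
  ...   | yes refl = map (cong (top ∷_)) there
                       (zeros-greatest (acc + wt top) (even+odd acc _ e wt-top-odd) xs)
  ...   | no x≢top = inj₂ (here-even e (≤∧≢⇒< (≤fromℕ x) (λ eq → x≢top (toℕ-injective eq))))

  -- By `reverse-order`, the least word at weight acc is the greatest word
  -- at weight acc + 1.
  minW : ℕ → ∀ k → W k
  minW acc = maxW (suc acc)

  minW-least : ∀ acc {k} (w : W k) → w ≡ minW acc k ⊎ GLess wt acc (minW acc k) w
  minW-least acc w = map₂ reverse-order (maxW-greatest (suc acc) w)

  zeros-extreme : ∀ k → All Extreme (toList (zeros k))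
  zeros-extreme zero = []
  zeros-extreme (suc k) = inj₁ refl ∷ zeros-extreme k

  largest-extreme : ∀ acc → Extreme (largest acc)
  largest-extreme acc with even? acc
  ... | yes _ = inj₂ (toℕ-fromℕ (suc r))
  ... | no _ = inj₁ refl

  maxW-extreme : ∀ acc k → All Extreme (toList (maxW acc k))
  maxW-extreme acc zero = []
  maxW-extreme acc (suc k) = largest-extreme acc ∷ zeros-extreme k

  extremal-adjacent : ∀ (a b : Fin Q) (α β k : ℕ) → TwoAdjacent (a ∷ maxW α k) (b ∷ maxW β k)
  extremal-adjacent a b α β zero fz fz _ _ = z≤n
  extremal-adjacent a b α β (suc k) = twoAdjacent-front a b _ _ (zeros k)

  Between : (List (Fin Q) → Set) → ℕ → ∀ {k} → W k → W k → Set
  Between Av acc {k} s t = Σ (W k) λ w → Av (toList w) × GLess wt acc s w × GLess wt acc w t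

  -- Consecutive words of Av that already differ in their first letter:
  -- their tails must be the extremal words, else those would lie between.
  adjacent-at-first-difference :
    ∀ Av → SuffixStable Extreme Av → ∀ {acc k} a b (x y : W k) →
    (∀ {x′ y′ : W k} → GLess wt acc (a ∷ x′) (b ∷ y′)) →
    Av (toList (a ∷ x)) → Av (toList (b ∷ y)) → ¬ Between Av acc (a ∷ x) (b ∷ y) →
    TwoAdjacent (a ∷ x) (b ∷ y)
  adjacent-at-first-difference Av stable {acc} {k} a b x y a<b avs avt none
    with maxW-greatest (acc + wt a) x | minW-least (acc + wt b) y
  ... | inj₂ x<max | _ = ⊥-elim (none (a ∷ maxW (acc + wt a) k ,
          stable [ a ] (toList x) (maxW-extreme _ k) avs , there x<max , a<b))
  ... | inj₁ refl | inj₂ min<y = ⊥-elim (none (b ∷ minW (acc + wt b) k ,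
          stable [ b ] (toList y) (maxW-extreme _ k) avt , a<b , there min<y))
  ... | inj₁ refl | inj₁ refl = extremal-adjacent a b _ _ k

  -- Gray-code property: consecutive words of a language stable under
  -- extreme suffixes are
  -- 2-adjacent.  A common first letter c is absorbed into the language.
  gray-code : ∀ Av → SuffixStable Extreme Av → ∀ {acc k} {s t : W k} → GLess wt acc s t →
              Av (toList s) → Av (toList t) → ¬ Between Av acc s t → TwoAdjacent s t
  gray-code Av stable (here-even e lt) =
    adjacent-at-first-difference Av stable _ _ _ _ (here-even e lt)
  gray-code Av stable (here-odd o lt) =
    adjacent-at-first-difference Av stable _ _ _ _ (here-odd o lt)
  gray-code Av stable (there {x = c} lt) avs avt none =
    twoAdjacent-∷ c (gray-code (λ L → Av (c List.∷ L)) (λ L → stable (c List.∷ L)) lt avs avt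
      (λ (w , avw , s<w , w<t) → none (c ∷ w , avw , there s<w , there w<t)))

-- The theorem: q = r + 2; for q even use ≺ (the top letter q-1 has odd
-- weight), for q odd use ◁ (the top letter has weight (q-1)+1 = q, odd).
-- Avoiding f is stable under extreme suffixes as the last letter of f is
-- not extreme.
proposition12 : (q n m : ℕ) → 2 ≤ q → 1 ≤ n →
    (f : Vec (Fin q) (suc m)) → toℕ (last f) ≢ 0 → toℕ (last f) ≢ q ∸ 1 →
    (s t : Word q n) → Consecutive (GrayOrder q) f s t → TwoAdjacent s t
proposition12 (suc (suc r)) n m (s≤s (s≤s _)) _ f last≢0 last≢top s t
              (avs , avt , inj₁ (q-even , s≺t) , none) =
  ReflectedOrder.gray-code r wt≺ refl top-odd (FreeOf f)
    (avoidance-stable Extreme f [ last≢0 , last≢top ]′) s≺t avs avt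
    (λ (w , avw , s≺w , w≺t) → none (w , avw , inj₁ (q-even , s≺w) , inj₁ (q-even , w≺t)))
  where
  top-odd : ¬ Even (toℕ (fromℕ (suc r)))
  top-odd = subst (λ a → ¬ Even a) (sym (toℕ-fromℕ (suc r))) (even-suc (suc r) q-even)
proposition12 (suc (suc r)) n m (s≤s (s≤s _)) _ f last≢0 last≢top s t
              (avs , avt , inj₂ (q-odd , s◁t) , none) =
  ReflectedOrder.gray-code r wt◁ refl top-odd (FreeOf f)
    (avoidance-stable Extreme f [ last≢0 , last≢top ]′) s◁t avs avt
    (λ (w , avw , s◁w , w◁t) → none (w , avw , inj₂ (q-odd , s◁w) , inj₂ (q-odd , w◁t)))
  where
  top-odd : ¬ Even (wt◁ (fromℕ (suc r)))
  top-odd = subst (λ a → ¬ Even (a + nz a)) (sym (toℕ-fromℕ (suc r)))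
                  (subst (λ a → ¬ Even a) (sym (+-comm (suc r) 1)) q-odd)
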